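{- Let $k$ be a positive integer and let $T$ be a tree rooted at a vertex $x$. Suppose $x$ has children $v_1,\dots,v_d$ (and possibly other children) such that every inclusive-descendant of $v_1,\dots,v_d$ is within distance $\lfloor k/2\rfloor$ of $x$, and there is a leaf $\ell$ that is an inclusive-descendant of $v_1$ at distance exactly $\lfloor k/2\rfloor$ from $x$. Let $T_1$ be the tree obtained from $T$ by deleting $v_2,\dots,v_d$, all descendants of $v_2,\dots,v_d$, and all descendants of $v_1$ except those on the $v_1\ell$-path (nothing of $v_1$'s descendants is kept if $v_1=\ell$). Then $\gamma_{all,k}^\infty(T_1)=\gamma_{all,k}^\infty(T)$.
   Context: The inclusive-descendants of a vertex $v$ in a rooted tree are $v$ together with all its descendants. Graphs are finite and simple; $d(u,v)$ is graph distance and $N_k[x]=\{v: d(x,v)\le k\}$. A multiset $D$ of vertices of $G$ is a distance-$k$ dominating set if every vertex of $V(G)\setminus D$ is at distance at most $k$ from some element of $D$. Let $\mathbb{D}_{k,q}(G)$ be the set of such multisets of cardinality $q$. $D=\{v_1,\dots,v_q\}$ transforms to $D'=\{u_1,\dots,u_q\}$ if (for some indexing) $u_i\in N_k[v_i]$ for all $i$. An eternal distance-$k$ dominating family is $\mathcal{E}\subseteq\mathbb{D}_{k,q}(G)$ for some $q$ such that for every $D\in\mathcal{E}$ and every vertex $v$ there is $D'\in\mathcal{E}$ with $v\in D'$ and $D$ transforms to $D'$. $\gamma_{all,k}^\infty(G)$ is the minimum $q$ for which such a family exists. -}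

module Defs where

open import Data.Nat using (ℕ; zero; suc; _+_; _≤_; _<_)
open import Data.Fin using (Fin; zero; suc; inject₁; fromℕ)
open import Data.Bool using (Bool; true)
open import Data.Product using (Σ; ∃; ∃-syntax; _×_; _,_; proj₁)
open import Data.Empty using (⊥)
open import Data.Irrelevant using (Irrelevant)
open import Data.Fin.Permutation using (Permutation′; _⟨$⟩ʳ_)
open import Function.Definitions using (Injective)
open import Relation.Nullary using (¬_)
open import Relation.Binary.PropositionalEquality using (_≡_; _≢_)

record Graph : Set₁ where
  field
    V : Set
    E : V → V → Set
open Graph public

data Walk (G : Graph) : V G → V G → ℕ → Set where
  nil  : ∀ {u} → Walk G u u 0
  cons : ∀ {u w v m} → E G u w → Walk G w v m → Walk G u v (suc m)

WithinDist : (G : Graph) → ℕ → V G → V G → Set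
WithinDist G k u v = ∃[ m ] (m ≤ k × Walk G u v m)

Dist : (G : Graph) → V G → V G → ℕ → Set
Dist G u v m = Walk G u v m × (∀ m′ → Walk G u v m′ → m ≤ m′)

-- Multisets of size q are represented by indexings  Fin q → V G

_∈ₘ_ : {G : Graph} {q : ℕ} → V G → (Fin q → V G) → Set
v ∈ₘ D = ∃[ i ] (D i ≡ v)

IsDistDom : (k : ℕ) (G : Graph) {q : ℕ} → (Fin q → V G) → Set
IsDistDom k G {q} D = ∀ (v : V G) → (_∈ₘ_ {G} v D) Data.Sum.⊎ (∃[ i ] WithinDist G k (D i) v)
  where import Data.Sum

Transforms : (k : ℕ) (G : Graph) {q : ℕ} → (Fin q → V G) → (Fin q → V G) → Set
Transforms k G {q} D D′ =
  Σ (Permutation′ q) λ σ → ∀ i → WithinDist G k (D i) (D′ (σ ⟨$⟩ʳ i))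

record EternalFamily (k : ℕ) (G : Graph) (q : ℕ) : Set₁ where
  field
    Mem      : (Fin q → V G) → Set
    nonempty : ∃[ D ] Mem D
    dom      : ∀ D → Mem D → IsDistDom k G D
    eternal  : ∀ D → Mem D → ∀ (v : V G) →
               ∃[ D′ ] (Mem D′ × _∈ₘ_ {G} v D′ × Transforms k G D D′)

IsGammaAllInf : (k : ℕ) (G : Graph) (q : ℕ) → Set₁
IsGammaAllInf k G q = EternalFamily k G q × (∀ q′ → q′ < q → ¬ EternalFamily k G q′)

record SimpleGraph (n : ℕ) : Set where
  field
    adj     : Fin n → Fin n → Bool
    sym     : ∀ u v → adj u v ≡ adj v u
    irrefl  : ∀ u → adj u u ≡ true → ⊥
open SimpleGraph public

toGraph : ∀ {n} → SimpleGraph n → Graph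
toGraph {n} G = record { V = Fin n ; E = λ u v → adj G u v ≡ true }

Connected : Graph → Set
Connected G = ∀ u v → ∃[ m ] Walk G u v m

HasCycle : Graph → Set
HasCycle G = ∃[ m ] Σ (Fin (suc (suc (suc m))) → V G) λ f →
  Injective _≡_ _≡_ f ×
  (∀ (i : Fin (suc (suc m))) → E G (f (inject₁ i)) (f (suc i))) ×
  E G (f (fromℕ (suc (suc m)))) (f zero)

IsTree : Graph → Set
IsTree G = Connected G × ¬ HasCycle G

IncDesc : (G : Graph) (x v u : V G) → Set
IncDesc G x v u = ∃[ a ] ∃[ b ] (Dist G x v a × Dist G v u b × Dist G x u (a + b))

IsLeaf : (G : Graph) → V G → Set
IsLeaf G ℓ = ∃[ w ] (E G ℓ w × (∀ w′ → E G ℓ w′ → w′ ≡ w))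

-- Induced subgraph on a vertex predicate (proof-irrelevant membership, so
-- vertices are identified exactly when their underlying vertices are equal)

Induced : ∀ {n} → SimpleGraph n → (Fin n → Set) → Graph
Induced {n} G S = record
  { V = Σ (Fin n) (λ u → Irrelevant (S u))
  ; E = λ a b → adj G (proj₁ a) (proj₁ b) ≡ true }

-- Vertices kept in T₁: not an inclusive-descendant of v₂..v_d, and not a
-- descendant of v₁ off the v₁ℓ-path (the v₁ℓ-path = inclusive-descendants
-- of v₁ of which ℓ is an inclusive-descendant).
Keep : ∀ {n d} (T : SimpleGraph n) (x : Fin n) (vs : Fin (suc d) → Fin n) (ℓ : Fin n)
       → Fin n → Set
Keep T x vs ℓ u =
  (¬ (∃[ i ] IncDesc (toGraph T) x (vs (suc i)) u)) ×
  (¬ (IncDesc (toGraph T) x (vs zero) u × ¬ IncDesc (toGraph T) x u ℓ))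

{-# OPTIONS --safe #-}
module Submission where

-- Every deleted vertex lies in the branch below some v_i, and branch vertices have depth at
-- most ⌊k/2⌋, so any two of them are within distance k through x.  Since T is a tree, a walk
-- leaving a branch passes through x, so its length is at least the sum of the depths of its
-- ends.  Hence, as far as being within distance k is concerned, a deleted vertex may be
-- replaced by x when passing from T to T₁, and by the deepest branch vertex ℓ when passing
-- from T₁ to T.  Doing this guard by guard turns an eternal distance-k dominating family of
-- either tree into one of the other tree of the same size.

open import Defs hiding (sym)
open import Data.Nat using (ℕ; zero; suc; _+_; _≤_; _<_; z≤n; s≤s; s≤s⁻¹; ⌊_/2⌋)
open import Data.Nat.Properties
open import Data.Fin using (Fin; zero; suc; toℕ; fromℕ; fromℕ<; inject₁)
open import Data.Fin.Properties
  using (any?; ¬∀⟶∃¬-smallest; toℕ-fromℕ; toℕ-fromℕ<; toℕ-inject)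
  renaming (_≟_ to _≟ᶠ_; 0≢1+n to zero≢suc)
open import Data.Bool using (true)
import Data.Bool.Properties as Bool
open import Data.Product using (∃; ∃-syntax; _×_; _,_; proj₁; proj₂)
open import Data.Sum using (_⊎_; inj₁; inj₂)
import Data.Sum as Sum
open import Data.Empty using (⊥; ⊥-elim)
open import Data.Irrelevant using ([_])
import Data.Irrelevant as Irrelevant
open import Data.Vec using (Vec; []; _∷_; _∷ʳ_; lookup)
open import Data.Vec.Relation.Unary.All as All using (All; []; _∷_)
open import Data.Vec.Relation.Unary.AllPairs using ([]; _∷_)
open import Data.Vec.Relation.Unary.Unique.Propositional using (Unique)
open import Data.Vec.Relation.Unary.Unique.Propositional.Properties using (lookup-injective)
open import Data.Vec.Relation.Unary.Linked using (Linked; []; [-]; _∷_)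
open import Data.Vec.Functional using (updateAt)
open import Data.Vec.Functional.Properties using (updateAt-updates; updateAt-minimal)
open import Data.Fin.Permutation using (_⟨$⟩ʳ_)
open import Function.Base using (_∘_; const)
open import Function.Bundles using (_⇔_; mk⇔; Equivalence)
open import Function.Definitions using (Injective)
open import Relation.Nullary using (¬_; Dec; yes; no; ¬?)
open import Relation.Nullary.Decidable using (_×-dec_; _⊎-dec_; decidable-stable)
open import Relation.Unary using (Decidable)
open import Relation.Binary.PropositionalEquality
open import Relation.Binary.Definitions using (tri<; tri≈; tri>)

open Equivalence using (to; from)

_++ʷ_ : ∀ {G : Graph} {u v w m m′} → Walk G u v m → Walk G v w m′ → Walk G u w (m + m′)
nil      ++ʷ W′ = W′
cons e W ++ʷ W′ = cons e (W ++ʷ W′)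

module _ {G : Graph} (E-sym : ∀ {a b} → E G a b → E G b a) where

  reverseʷ : ∀ {u v m} → Walk G u v m → Walk G v u m
  reverseʷ nil = nil
  reverseʷ {m = suc m} (cons e W) =
    subst (Walk G _ _) (+-comm m 1) (reverseʷ W ++ʷ cons (E-sym e) nil)

  within-sym : ∀ {k u v} → WithinDist G k u v → WithinDist G k v u
  within-sym (m , m≤k , W) = m , m≤k , reverseʷ W

within-refl : ∀ {G : Graph} {k u} → WithinDist G k u u
within-refl = 0 , z≤n , nil

within-trans : ∀ {G : Graph} {a b u v w} →
               WithinDist G a u v → WithinDist G b v w → WithinDist G (a + b) u w
within-trans (m , m≤a , W) (m′ , m′≤b , W′) = m + m′ , +-mono-≤ m≤a m′≤b , W ++ʷ W′

within-weaken : ∀ {G : Graph} {a b u v} → a ≤ b → WithinDist G a u v → WithinDist G b u v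
within-weaken a≤b (m , m≤a , W) = m , ≤-trans m≤a a≤b , W

adj-sym : ∀ {n} (T : SimpleGraph n) {a b} → adj T a b ≡ true → adj T b a ≡ true
adj-sym T {a} {b} = trans (SimpleGraph.sym T b a)

-- Simulations transport eternal dominating families

record Simulation (k : ℕ) (G H : Graph) : Set₁ where
  field
    _∼_              : V G → V H → Set
    image            : ∀ u → ∃ (u ∼_)
    preimage         : ∀ w → ∃ (_∼ w)
    preserves-within : ∀ {u u′ w w′} → u ∼ w → u′ ∼ w′ →
                       WithinDist G k u u′ → WithinDist H k w w′

dominator-within : ∀ {k G q} {D : Fin q → V G} → IsDistDom k G D →
                   ∀ v → ∃[ i ] WithinDist G k (D i) v
dominator-within dom v with dom v
... | inj₁ (i , refl) = i , within-refl
... | inj₂ near       = near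

module _ {k G H} (S : Simulation k G H) where
  open Simulation S

  simulate-eternal : ∀ {q} → EternalFamily k G q → EternalFamily k H q
  simulate-eternal {q} F =
    record { Mem = Mem′ ; nonempty = nonempty′ ; dom = dom′ ; eternal = eternal′ }
    where
    open EternalFamily F

    Mem′ : (Fin q → V H) → Set
    Mem′ D′ = ∃[ D ] (Mem D × ∀ i → D i ∼ D′ i)

    nonempty′ : ∃ Mem′
    nonempty′ with nonempty
    ... | D , D∈F = proj₁ ∘ image ∘ D , D , D∈F , proj₂ ∘ image ∘ D

    dom′ : ∀ D′ → Mem′ D′ → IsDistDom k H D′
    dom′ D′ (D , D∈F , D∼D′) w with preimage w
    ... | u , u∼w with dominator-within (dom D D∈F) u
    ...   | i , near = inj₂ (i , preserves-within (D∼D′ i) u∼w near)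

    eternal′ : ∀ D′ → Mem′ D′ → ∀ w →
               ∃[ D⁺′ ] (Mem′ D⁺′ × _∈ₘ_ {H} w D⁺′ × Transforms k H D′ D⁺′)
    eternal′ D′ (D , D∈F , D∼D′) w with preimage w
    ... | u , u∼w with eternal D D∈F u
    ...   | D⁺ , D⁺∈F , (j , D⁺j≡u) , σ , moves =
      D⁺′ , (D⁺ , D⁺∈F , D⁺∼D⁺′) , (j , updateAt-updates j _) ,
      σ , λ i → preserves-within (D∼D′ i) (D⁺∼D⁺′ (σ ⟨$⟩ʳ i)) (moves i)
      where
      D⁺′ : Fin q → V H
      D⁺′ = updateAt (proj₁ ∘ image ∘ D⁺) j (const w)

      D⁺∼D⁺′ : ∀ i → D⁺ i ∼ D⁺′ i
      D⁺∼D⁺′ i with i ≟ᶠ j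
      ... | yes refl = subst₂ _∼_ (sym D⁺j≡u) (sym (updateAt-updates j _)) u∼w
      ... | no i≢j   = subst (D⁺ i ∼_) (sym (updateAt-minimal i j _ i≢j)) (proj₂ (image (D⁺ i)))

IsGammaAllInf-⇔ : ∀ {k G H} → Simulation k G H → Simulation k H G →
                  ∀ q → IsGammaAllInf k G q ⇔ IsGammaAllInf k H q
IsGammaAllInf-⇔ {k} G→H H→G q = mk⇔ (transport G→H H→G) (transport H→G G→H)
  where
  transport : ∀ {G H} → Simulation k G H → Simulation k H G → IsGammaAllInf k G q → IsGammaAllInf k H q
  transport there back (F , minimal) =
    simulate-eternal there F , λ q′ q′<q F′ → minimal q′ q′<q (simulate-eternal back F′)

-- Distances in a connected simple graph

least : (P : ℕ → Set) → Decidable P → ∀ {m} → P m → ∃[ n ] (P n × ∀ {n′} → P n′ → n ≤ n′)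
least P P? {m} Pm
  with ¬∀⟶∃¬-smallest (suc m) (¬_ ∘ P ∘ toℕ) (¬? ∘ P? ∘ toℕ)
         (λ ¬¬P → ¬¬P (fromℕ m) (subst P (sym (toℕ-fromℕ m)) Pm))
... | i , ¬¬Pi , below = toℕ i , decidable-stable (P? (toℕ i)) ¬¬Pi , minimal
  where
  minimal : ∀ {n′} → P n′ → toℕ i ≤ n′
  minimal Pn′ = ≮⇒≥ λ n′<i →
    below (fromℕ< n′<i) (subst P (sym (trans (toℕ-inject (fromℕ< n′<i)) (toℕ-fromℕ< n′<i))) Pn′)

module Metric {n} (T : SimpleGraph n) (connected : Connected (toGraph T)) where

  G : Graph
  G = toGraph T

  E-sym : ∀ {a b} → E G a b → E G b a
  E-sym = adj-sym T

  E⇒≢ : ∀ {a b} → E G a b → a ≢ b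
  E⇒≢ {a} e refl = irrefl T a e

  walk? : ∀ m u v → Dec (Walk G u v m)
  walk? zero u v with u ≟ᶠ v
  ... | yes refl = yes nil
  ... | no u≢v   = no λ { nil → u≢v refl }
  walk? (suc m) u v with any? (λ w → (adj T u w Bool.≟ true) ×-dec walk? m w v)
  ... | yes (w , e , W) = yes (cons e W)
  ... | no ¬step        = no λ { (cons e W) → ¬step (_ , e , W) }

  shortest : ∀ u v → ∃[ m ] (Walk G u v m × ∀ {m′} → Walk G u v m′ → m ≤ m′)
  shortest u v = least (λ m → Walk G u v m) (λ m → walk? m u v) (proj₂ (connected u v))

  dist : Fin n → Fin n → ℕ
  dist u v = proj₁ (shortest u v)

  dist-walk : ∀ u v → Walk G u v (dist u v)
  dist-walk u v = proj₁ (proj₂ (shortest u v))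

  dist-minimal : ∀ {u v m} → Walk G u v m → dist u v ≤ m
  dist-minimal {u} {v} = proj₂ (proj₂ (shortest u v))

  dist-refl : ∀ u → dist u u ≡ 0
  dist-refl u = n≤0⇒n≡0 (dist-minimal (nil {u = u}))

  dist≡0⇒≡ : ∀ {u v} → dist u v ≡ 0 → u ≡ v
  dist≡0⇒≡ {u} {v} d≡0 = walk₀ (subst (Walk G u v) d≡0 (dist-walk u v))
    where
    walk₀ : ∀ {a b} → Walk G a b 0 → a ≡ b
    walk₀ nil = refl

  dist-sym : ∀ u v → dist u v ≡ dist v u
  dist-sym u v = ≤-antisym (dist-minimal (reverseʷ E-sym (dist-walk v u)))
                           (dist-minimal (reverseʷ E-sym (dist-walk u v)))

  dist-triangle : ∀ u v w → dist u w ≤ dist u v + dist v w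
  dist-triangle u v w = dist-minimal (dist-walk u v ++ʷ dist-walk v w)

  dist-step : ∀ {u v w} → E G v w → dist u w ≤ suc (dist u v)
  dist-step {u} {v} {w} e = begin
    dist u w            ≤⟨ dist-triangle u v w ⟩
    dist u v + dist v w ≤⟨ +-monoʳ-≤ (dist u v) (dist-minimal (cons e nil)) ⟩
    dist u v + 1        ≡⟨ +-comm (dist u v) 1 ⟩
    suc (dist u v)      ∎
    where open ≤-Reasoning

  within⇔ : ∀ {k u v} → WithinDist G k u v ⇔ dist u v ≤ k
  within⇔ {u = u} {v} = mk⇔ (λ (m , m≤k , W) → ≤-trans (dist-minimal W) m≤k)
                            (λ d≤k → dist u v , d≤k , dist-walk u v)

  Dist⇒≡dist : ∀ {u v a} → Dist G u v a → a ≡ dist u v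
  Dist⇒≡dist {u} {v} (W , minimal) = ≤-antisym (minimal _ (dist-walk u v)) (dist-minimal W)

  dist-Dist : ∀ u v → Dist G u v (dist u v)
  dist-Dist u v = dist-walk u v , λ _ → dist-minimal

  IncDesc⇔ : ∀ {x a b} → IncDesc G x a b ⇔ (dist x a + dist a b ≡ dist x b)
  IncDesc⇔ {x} {a} {b} = mk⇔
    (λ (_ , _ , xa , ab , xb) →
       trans (cong₂ _+_ (sym (Dist⇒≡dist xa)) (sym (Dist⇒≡dist ab))) (Dist⇒≡dist xb))
    (λ eq → dist x a , dist a b , dist-Dist x a , dist-Dist a b ,
            subst (Dist G x b) (sym eq) (dist-Dist x b))

-- Simple paths and cycles as vectors

module _ {A : Set} where

  All-∷ʳ⁺ : ∀ {P : A → Set} {m} {xs : Vec A m} {y} → All P xs → P y → All P (xs ∷ʳ y)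
  All-∷ʳ⁺ []         py = py ∷ []
  All-∷ʳ⁺ (px ∷ pxs) py = px ∷ All-∷ʳ⁺ pxs py

  Unique-∷ʳ⁺ : ∀ {m} {xs : Vec A m} {y} → Unique xs → All (_≢ y) xs → Unique (xs ∷ʳ y)
  Unique-∷ʳ⁺ []           []          = [] ∷ []
  Unique-∷ʳ⁺ (x∉xs ∷ xs!) (x≢y ∷ xs≢y) = All-∷ʳ⁺ x∉xs x≢y ∷ Unique-∷ʳ⁺ xs! xs≢y

  Linked-∷ʳ⁺ : ∀ {R : A → A → Set} {m} (xs : Vec A m) {y z} →
               Linked R (xs ∷ʳ y) → R y z → Linked R (xs ∷ʳ y ∷ʳ z)
  Linked-∷ʳ⁺ []           [-]       r = r ∷ [-]
  Linked-∷ʳ⁺ (x ∷ [])     (r′ ∷ rs) r = r′ ∷ Linked-∷ʳ⁺ [] rs r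
  Linked-∷ʳ⁺ (x ∷ x′ ∷ xs) (r′ ∷ rs) r = r′ ∷ Linked-∷ʳ⁺ (x′ ∷ xs) rs r

  Linked-lookup : ∀ {R : A → A → Set} {m} {xs : Vec A (suc m)} → Linked R xs →
                  ∀ i → R (lookup xs (inject₁ i)) (lookup xs (suc i))
  Linked-lookup {xs = _ ∷ _ ∷ _} (r ∷ rs) zero    = r
  Linked-lookup {xs = _ ∷ _ ∷ _} (r ∷ rs) (suc i) = Linked-lookup rs i

  lookup-∷ʳ-fromℕ : ∀ {m} (xs : Vec A m) y → lookup (xs ∷ʳ y) (fromℕ m) ≡ y
  lookup-∷ʳ-fromℕ []       y = refl
  lookup-∷ʳ-fromℕ (x ∷ xs) y = lookup-∷ʳ-fromℕ xs y

cycle : ∀ {G : Graph} {m} (xs : Vec (V G) (suc (suc (suc m)))) →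
        Unique xs → Linked (E G) xs → E G (lookup xs (fromℕ (suc (suc m)))) (lookup xs zero) →
        HasCycle G
cycle xs xs! linked closing =
  _ , lookup xs , (λ {i} {j} → lookup-injective xs! i j) , Linked-lookup linked , closing

-- Rooted trees

module RootedTree {n} (T : SimpleGraph n) (tree : IsTree (toGraph T)) (x : Fin n) where

  open Metric T (proj₁ tree) public

  depth : Fin n → ℕ
  depth = dist x

  -- a ≼ b: b is an inclusive-descendant of a (compare IncDesc⇔).
  _≼_ : Fin n → Fin n → Set
  a ≼ b = depth a + dist a b ≡ depth b

  _≼?_ : ∀ a b → Dec (a ≼ b)
  a ≼? b = depth a + dist a b ≟ depth b

  Parent : Fin n → Fin n → Set
  Parent p u = E G p u × depth u ≡ suc (depth p)

  depth≡0 : ∀ {u} → depth u ≡ 0 → u ≡ x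
  depth≡0 = sym ∘ dist≡0⇒≡

  ≼-refl : ∀ {a} → a ≼ a
  ≼-refl {a} = trans (cong (depth a +_) (dist-refl a)) (+-identityʳ (depth a))

  root-≼ : ∀ {u} → x ≼ u
  root-≼ {u} = cong (_+ dist x u) (dist-refl x)

  ≼-trans : ∀ {a b c} → a ≼ b → b ≼ c → a ≼ c
  ≼-trans {a} {b} {c} a≼b b≼c = ≤-antisym upper (dist-triangle x a c)
    where
    open ≤-Reasoning
    upper : depth a + dist a c ≤ depth c
    upper = begin
      depth a + dist a c              ≤⟨ +-monoʳ-≤ (depth a) (dist-triangle a b c) ⟩
      depth a + (dist a b + dist b c) ≡⟨ sym (+-assoc (depth a) (dist a b) (dist b c)) ⟩
      depth a + dist a b + dist b c   ≡⟨ cong (_+ dist b c) a≼b ⟩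
      depth b + dist b c              ≡⟨ b≼c ⟩
      depth c                         ∎

  parent-≼ : ∀ {p u} → Parent p u → p ≼ u
  parent-≼ {p} {u} (e , du) = ≤-antisym upper (dist-triangle x p u)
    where
    upper : depth p + dist p u ≤ depth u
    upper = ≤-trans (+-monoʳ-≤ (depth p) (dist-minimal (cons e nil)))
                    (≤-reflexive (trans (+-comm (depth p) 1) (sym du)))

  ≼-parent : ∀ {a u} → a ≼ u → a ≡ u ⊎ ∃[ p ] (Parent p u × a ≼ p)
  ≼-parent {a} {u} a≼u with dist u a in du | dist-walk u a
  ... | zero  | _ = inj₁ (dist≡0⇒≡ (trans (dist-sym a u) du))
  ... | suc c | cons {w = p} e W =
    inj₂ (p , (E-sym e , ≤-antisym (dist-step (E-sym e)) deeper) , a≼p)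
    where
    open ≤-Reasoning
    du≡ : depth a + suc c ≡ depth u
    du≡ = trans (cong (depth a +_) (sym (trans (dist-sym a u) du))) a≼u
    dist-a-p : dist a p ≤ c
    dist-a-p = ≤-trans (≤-reflexive (dist-sym a p)) (dist-minimal W)
    deeper : suc (depth p) ≤ depth u
    deeper = begin
      suc (depth p)            ≤⟨ s≤s (dist-triangle x a p) ⟩
      suc (depth a + dist a p) ≤⟨ s≤s (+-monoʳ-≤ (depth a) dist-a-p) ⟩
      suc (depth a + c)        ≡⟨ sym (+-suc (depth a) c) ⟩
      depth a + suc c          ≡⟨ du≡ ⟩
      depth u                  ∎
    a≼p : a ≼ p
    a≼p = ≤-antisym (s≤s⁻¹ (begin
      suc (depth a + dist a p) ≤⟨ s≤s (+-monoʳ-≤ (depth a) dist-a-p) ⟩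
      suc (depth a + c)        ≡⟨ sym (+-suc (depth a) c) ⟩
      depth a + suc c          ≡⟨ du≡ ⟩
      depth u                  ≤⟨ dist-step (E-sym e) ⟩
      suc (depth p)            ∎)) (dist-triangle x a p)

  parent-at : ∀ {u t} → depth u ≡ suc t → ∃[ p ] (Parent p u × depth p ≡ t)
  parent-at {u} {t} du with ≼-parent (root-≼ {u})
  ... | inj₁ refl = ⊥-elim (1+n≢0 (trans (sym du) (dist-refl x)))
  ... | inj₂ (p , (e , du′) , _) = p , (e , du′) , suc-injective (trans (sym du′) du)

  edge-depth-+ : ∀ {u v a m} → E G u v → depth v + a ≤ m → depth u + a ≤ suc m
  edge-depth-+ {a = a} e le = ≤-trans (+-monoˡ-≤ a (dist-step (E-sym e))) (s≤s le)

  within-via-root : ∀ {k u v} → depth u + depth v ≤ k → WithinDist G k u v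
  within-via-root {v = v} le = within-weaken le
    (within-trans (within-sym E-sym (from within⇔ ≤-refl)) (from within⇔ (≤-refl {depth v})))

  shallower-∉ : ∀ {p t s} {vs : Vec (Fin n) s} → depth p ≡ t →
                All (λ v → suc t ≤ depth v) vs → All (p ≢_) vs
  shallower-∉ {t = t} dp = All.map λ t<v p≡v →
    1+n≰n (subst (suc t ≤_) (trans (cong depth (sym p≡v)) dp) t<v)

  -- Replacing both ends by their parents closes a cycle or gives such a path one level up.
  no-level-path : ∀ t {s} u w (mid : Vec (Fin n) s) → u ≢ w → depth u ≡ t → depth w ≡ t →
                  All (λ v → t ≤ depth v) mid →
                  Unique ((u ∷ mid) ∷ʳ w) → Linked (E G) ((u ∷ mid) ∷ʳ w) → ⊥
  no-level-path zero u w mid u≢w du dw _ _ _ = u≢w (trans (depth≡0 du) (sym (depth≡0 dw)))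
  no-level-path (suc t) u w mid u≢w du dw high path! path = climb (parent-at du) (parent-at dw)
    where
    deep : All (λ v → suc t ≤ depth v) ((u ∷ mid) ∷ʳ w)
    deep = ≤-reflexive (sym du) ∷ All-∷ʳ⁺ high (≤-reflexive (sym dw))

    climb : ∃[ p ] (Parent p u × depth p ≡ t) → ∃[ p ] (Parent p w × depth p ≡ t) → ⊥
    climb (pu , (pu-u , _) , dpu) (pw , (pw-w , _) , dpw) with pu ≟ᶠ pw
    ... | yes refl = proj₂ tree (cycle (pu ∷ ((u ∷ mid) ∷ʳ w))
                       (shallower-∉ dpu deep ∷ path!) (pu-u ∷ path)
                       (subst (λ z → E G z pu) (sym (lookup-∷ʳ-fromℕ mid w)) (E-sym pw-w)))
    ... | no pu≢pw = no-level-path t pu pw ((u ∷ mid) ∷ʳ w) pu≢pw dpu dpw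
                       (All.map (≤-trans (n≤1+n t)) deep)
                       (All-∷ʳ⁺ (shallower-∉ dpu deep) pu≢pw ∷
                        Unique-∷ʳ⁺ path! (All.map (_∘ sym) (shallower-∉ dpw deep)))
                       (pu-u ∷ Linked-∷ʳ⁺ (u ∷ mid) path (E-sym pw-w))

  no-level-edge : ∀ {u w} → E G u w → depth u ≢ depth w
  no-level-edge {u} {w} e du≡dw = no-level-path (depth u) u w [] (E⇒≢ e) refl (sym du≡dw) []
    ((E⇒≢ e ∷ []) ∷ [] ∷ []) (e ∷ [-])

  parents-unique : ∀ {p q u} → Parent p u → Parent q u → p ≡ q
  parents-unique {p} {q} {u} (p-u , du) (q-u , du′) with p ≟ᶠ q
  ... | yes p≡q = p≡q
  ... | no p≢q  = ⊥-elim (no-level-path (depth p) p q (u ∷ []) p≢q refl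
    (suc-injective (trans (sym du′) du)) (≤-trans (n≤1+n (depth p)) (≤-reflexive (sym du)) ∷ [])
    ((E⇒≢ p-u ∷ p≢q ∷ []) ∷ (E⇒≢ (E-sym q-u) ∷ []) ∷ [] ∷ []) (p-u ∷ E-sym q-u ∷ [-]))

  module Branch {c} (x-c : E G x c) where

    depth-child : depth c ≡ 1
    depth-child = ≤-antisym (dist-minimal (cons x-c nil)) (n≢0⇒n>0 (E⇒≢ x-c ∘ dist≡0⇒≡))

    ⋠root : ¬ c ≼ x
    ⋠root c≼x = 1+n≢0 (trans (cong (_+ dist c x) (sym depth-child)) (trans c≼x (dist-refl x)))

    branch-exit : ∀ {z z′} → c ≼ z → E G z z′ → ¬ c ≼ z′ → z′ ≡ x
    branch-exit {z} {z′} c≼z e c⋠z′ with <-cmp (depth z′) (depth z)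
    ... | tri≈ _ same _   = ⊥-elim (no-level-edge e (sym same))
    ... | tri> _ _ deeper =
      ⊥-elim (c⋠z′ (≼-trans c≼z (parent-≼ (e , ≤-antisym (dist-step e) deeper))))
    ... | tri< shallower _ _ with ≤-antisym (dist-step (E-sym e)) shallower | ≼-parent c≼z
    ...   | dz | inj₁ refl = depth≡0 (suc-injective (trans (sym dz) depth-child))
    ...   | dz | inj₂ (p , p-z , c≼p) =
      ⊥-elim (c⋠z′ (subst (c ≼_) (parents-unique p-z (E-sym e , dz)) c≼p))

    walk-out-of-branch : ∀ {u y m} → c ≼ u → ¬ c ≼ y → Walk G u y m → depth u + depth y ≤ m
    walk-out-of-branch c≼u c⋠y nil = ⊥-elim (c⋠y c≼u)
    walk-out-of-branch {y = y} c≼u c⋠y (cons {w = v} e W) with c ≼? v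
    ... | yes c≼v = edge-depth-+ e (walk-out-of-branch c≼v c⋠y W)
    ... | no c⋠v with branch-exit c≼u e c⋠v
    ...   | refl =
      edge-depth-+ e (≤-trans (≤-reflexive (cong (_+ depth y) (dist-refl x))) (dist-minimal W))

  branches-disjoint : ∀ {c c′ w} → E G x c → E G x c′ → c ≼ w → c′ ≼ w → c ≡ c′
  branches-disjoint {c} {c′} {w} x-c x-c′ c≼w c′≼w with c ≟ᶠ c′
  ... | yes c≡c′ = c≡c′
  ... | no c≢c′  = ⊥-elim (<-irrefl refl loop)
    where
    open ≤-Reasoning
    dc′ : depth c′ ≡ 1
    dc′ = Branch.depth-child x-c′

    c⋠c′ : ¬ c ≼ c′
    c⋠c′ c≼c′ = c≢c′ (dist≡0⇒≡ (suc-injective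
      (trans (cong (_+ dist c c′) (sym (Branch.depth-child x-c))) (trans c≼c′ dc′))))

    loop : depth w < depth w
    loop = begin-strict
      depth w               <⟨ m<m+n (depth w) (≤-reflexive (sym dc′)) ⟩
      depth w + depth c′    ≤⟨ Branch.walk-out-of-branch x-c c≼w c⋠c′ (dist-walk w c′) ⟩
      dist w c′             ≡⟨ dist-sym w c′ ⟩
      dist c′ w             <⟨ m<n+m (dist c′ w) (≤-reflexive (sym dc′)) ⟩
      depth c′ + dist c′ w  ≡⟨ c′≼w ⟩
      depth w               ∎

module Reduction (k n : ℕ) (T : SimpleGraph n) (tree : IsTree (toGraph T)) (x : Fin n)
  (d : ℕ) (vs : Fin (suc d) → Fin n) (vs-injective : Injective _≡_ _≡_ vs)
  (x-vs : ∀ i → adj T x (vs i) ≡ true)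
  (shallow : ∀ i u → IncDesc (toGraph T) x (vs i) u → WithinDist (toGraph T) ⌊ k /2⌋ x u)
  (ℓ : Fin n) (vs₀-ℓ : IncDesc (toGraph T) x (vs zero) ℓ) (depth-ℓ : Dist (toGraph T) x ℓ ⌊ k /2⌋)
  where

  open RootedTree T tree x

  InBranch : Fin n → Set
  InBranch u = ∃[ i ] (vs i ≼ u)

  InBranch? : ∀ u → Dec (InBranch u)
  InBranch? u = any? (λ i → vs i ≼? u)

  depth-InBranch : ∀ {u} → InBranch u → depth u ≤ ⌊ k /2⌋
  depth-InBranch {u} (i , b) = to within⇔ (shallow i u (from IncDesc⇔ b))

  vs₀≼ℓ : vs zero ≼ ℓ
  vs₀≼ℓ = to IncDesc⇔ vs₀-ℓ

  depthℓ : depth ℓ ≡ ⌊ k /2⌋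
  depthℓ = sym (Dist⇒≡dist depth-ℓ)

  Kept : Fin n → Set
  Kept u = (∀ j → ¬ vs (suc j) ≼ u) × ¬ (vs zero ≼ u × ¬ u ≼ ℓ)

  Keep⇔Kept : ∀ {u} → Keep T x vs ℓ u ⇔ Kept u
  Keep⇔Kept = mk⇔
    (λ (¬below , ¬off) → (λ j b → ¬below (j , from IncDesc⇔ b)) ,
                         (λ (b , ¬on) → ¬off (from IncDesc⇔ b , ¬on ∘ to IncDesc⇔)))
    (λ (¬below , ¬off) → (λ (j , b) → ¬below j (to IncDesc⇔ b)) ,
                         (λ (b , ¬on) → ¬off (to IncDesc⇔ b , ¬on ∘ from IncDesc⇔)))

  Kept-or-InBranch : ∀ u → Kept u ⊎ InBranch u
  Kept-or-InBranch u with any? (λ j → vs (suc j) ≼? u)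
  ... | yes (j , b) = inj₂ (suc j , b)
  ... | no ¬below with vs zero ≼? u | u ≼? ℓ
  ...   | no ¬b  | _       = inj₁ ((λ j b → ¬below (j , b)) , λ (b , _) → ¬b b)
  ...   | yes _  | yes on  = inj₁ ((λ j b → ¬below (j , b)) , λ (_ , ¬on) → ¬on on)
  ...   | yes b  | no _    = inj₂ (zero , b)

  ¬InBranch⇒Kept : ∀ {u} → ¬ InBranch u → Kept u
  ¬InBranch⇒Kept ¬b = (λ j b → ¬b (suc j , b)) , λ (b , _) → ¬b (zero , b)

  Kept-x : Kept x
  Kept-x = ¬InBranch⇒Kept λ (i , b) → Branch.⋠root (x-vs i) b

  Kept-ℓ : Kept ℓ
  Kept-ℓ =
    (λ j b → zero≢suc (vs-injective (branches-disjoint (x-vs zero) (x-vs (suc j)) vs₀≼ℓ b))) ,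
    λ (_ , ¬on) → ¬on ≼-refl

  Kept-parent : ∀ {p u} → Parent p u → Kept u → Kept p
  Kept-parent p-u (¬below , ¬off) =
    (λ j b → ¬below j (≼-trans b (parent-≼ p-u))) ,
    λ (b , ¬on) → ¬off (≼-trans b (parent-≼ p-u) , λ on → ¬on (≼-trans (parent-≼ p-u) on))

  G₁ : Graph
  G₁ = Induced T (Keep T x vs ℓ)

  vertex₁ : ∀ u → Kept u → V G₁
  vertex₁ u kept = u , [ from Keep⇔Kept kept ]

  x₁ : V G₁
  x₁ = vertex₁ x Kept-x

  project : ∀ {w w′ m} → Walk G₁ w w′ m → Walk G (proj₁ w) (proj₁ w′) m
  project nil        = nil
  project (cons e W) = cons e (project W)

  project-within : ∀ {w w′} → WithinDist G₁ k w w′ → WithinDist G k (proj₁ w) (proj₁ w′)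
  project-within (m , m≤k , W) = m , m≤k , project W

  walk-to-root₁ : ∀ t (w : V G₁) → depth (proj₁ w) ≡ t → Walk G₁ w x₁ t
  walk-to-root₁ zero (u , _) du with depth≡0 du
  ... | refl = nil
  walk-to-root₁ (suc t) (u , kept) du with parent-at du
  ... | p , p-u , dp = cons (E-sym (proj₁ p-u))
    (walk-to-root₁ t (p , Irrelevant.map (from Keep⇔Kept ∘ Kept-parent p-u ∘ to Keep⇔Kept) kept) dp)

  within-root₁ : ∀ w → WithinDist G₁ (depth (proj₁ w)) w x₁
  within-root₁ w = _ , ≤-refl , walk-to-root₁ _ w refl

  within-via-root₁ : ∀ {w w′} → depth (proj₁ w) + depth (proj₁ w′) ≤ k → WithinDist G₁ k w w′
  within-via-root₁ {w} {w′} le = within-weaken le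
    (within-trans (within-root₁ w) (within-sym {G = G₁} (λ {a} {b} → adj-sym T) (within-root₁ w′)))

  halves≤ : ⌊ k /2⌋ + ⌊ k /2⌋ ≤ k
  halves≤ = ≤-trans (+-monoʳ-≤ ⌊ k /2⌋ (⌊n/2⌋≤⌈n/2⌉ k)) (≤-reflexive (⌊n/2⌋+⌈n/2⌉≡n k))

  InBranch-within : ∀ {u u′} → InBranch u → WithinDist G k u u′ → depth u + depth u′ ≤ k
  InBranch-within {u′ = u′} bu wd with InBranch? u′
  ... | yes bu′ = ≤-trans (+-mono-≤ (depth-InBranch bu) (depth-InBranch bu′)) halves≤
  ... | no ¬bu′ with bu | wd
  ...   | i , b | m , m≤k , W =
    ≤-trans (Branch.walk-out-of-branch (x-vs i) b (λ b′ → ¬bu′ (i , b′)) W) m≤k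

  within-depth-bound : ∀ {u u′} → InBranch u ⊎ InBranch u′ → WithinDist G k u u′ →
                       depth u + depth u′ ≤ k
  within-depth-bound {u} {u′} (inj₁ bu)  wd = InBranch-within bu wd
  within-depth-bound {u} {u′} (inj₂ bu′) wd =
    subst (_≤ k) (+-comm (depth u′) (depth u)) (InBranch-within bu′ (within-sym E-sym wd))

  lift-or-via-root : ∀ {u u′ m} (W : Walk G u u′ m) (¬bu : ¬ InBranch u) (¬bu′ : ¬ InBranch u′) →
    Walk G₁ (vertex₁ u (¬InBranch⇒Kept ¬bu)) (vertex₁ u′ (¬InBranch⇒Kept ¬bu′)) m ⊎
    depth u + depth u′ ≤ m
  lift-or-via-root nil ¬bu ¬bu′ = inj₁ nil
  lift-or-via-root (cons {w = v} e W) ¬bu ¬bu′ with InBranch? v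
  ... | yes (i , b) =
    inj₂ (edge-depth-+ e (Branch.walk-out-of-branch (x-vs i) b (λ b′ → ¬bu′ (i , b′)) W))
  ... | no ¬bv with lift-or-via-root W ¬bv ¬bu′
  ...   | inj₁ W₁ = inj₁ (cons e W₁)
  ...   | inj₂ le = inj₂ (edge-depth-+ e le)

  data Represents (r u : Fin n) (w : V G₁) : Set where
    itself  : proj₁ w ≡ u → Represents r u w
    instead : InBranch u → proj₁ w ≡ r → Represents r u w

  represent : ∀ {r} → Kept r → ∀ u → ∃ (Represents r u)
  represent kept-r u with Kept-or-InBranch u
  ... | inj₁ kept = vertex₁ u kept , itself refl
  ... | inj₂ bu   = vertex₁ _ kept-r , instead bu refl

  Represents-¬InBranch : ∀ {r u w} → Represents r u w → ¬ InBranch u → proj₁ w ≡ u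
  Represents-¬InBranch (itself eq)    _   = eq
  Represents-¬InBranch (instead bu _) ¬bu = ⊥-elim (¬bu bu)

  Represents-x-depth : ∀ {u w} → Represents x u w → depth (proj₁ w) ≤ depth u
  Represents-x-depth (itself refl)  = ≤-refl
  Represents-x-depth (instead _ eq) =
    ≤-trans (≤-reflexive (trans (cong depth eq) (dist-refl x))) z≤n

  Represents-ℓ-depth : ∀ {u w} → Represents ℓ u w → depth u ≤ depth (proj₁ w)
  Represents-ℓ-depth (itself refl)   = ≤-refl
  Represents-ℓ-depth (instead bu eq) =
    ≤-trans (depth-InBranch bu) (≤-reflexive (sym (trans (cong depth eq) depthℓ)))

  Represents-ℓ-InBranch : ∀ {u w} → Represents ℓ u w → InBranch u → InBranch (proj₁ w)
  Represents-ℓ-InBranch (itself refl)  bu = bu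
  Represents-ℓ-InBranch (instead _ eq) _  = zero , subst (vs zero ≼_) (sym eq) vs₀≼ℓ

  collapse : Simulation k G G₁
  collapse = record
    { _∼_              = Represents x
    ; image            = represent Kept-x
    ; preimage         = λ w → proj₁ w , itself refl
    ; preserves-within = preserves
    }
    where
    preserves : ∀ {u u′ w w′} → Represents x u w → Represents x u′ w′ →
                WithinDist G k u u′ → WithinDist G₁ k w w′
    preserves {u} {u′} rw rw′ wd with InBranch? u ⊎-dec InBranch? u′
    ... | yes some = within-via-root₁ (≤-trans
      (+-mono-≤ (Represents-x-depth rw) (Represents-x-depth rw′))
      (within-depth-bound some wd))
    ... | no none
      with Represents-¬InBranch rw (none ∘ inj₁) | Represents-¬InBranch rw′ (none ∘ inj₂) | wd
    ...   | refl | refl | m , m≤k , W with lift-or-via-root W (none ∘ inj₁) (none ∘ inj₂)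
    ...     | inj₁ W₁ = m , m≤k , W₁
    ...     | inj₂ le = within-via-root₁ (≤-trans le m≤k)

  expand : Simulation k G₁ G
  expand = record
    { _∼_              = λ w u → Represents ℓ u w
    ; image            = λ w → proj₁ w , itself refl
    ; preimage         = represent Kept-ℓ
    ; preserves-within = preserves
    }
    where
    preserves : ∀ {w w′ u u′} → Represents ℓ u w → Represents ℓ u′ w′ →
                WithinDist G₁ k w w′ → WithinDist G k u u′
    preserves {u = u} {u′} rw rw′ wd with InBranch? u ⊎-dec InBranch? u′
    ... | yes some = within-via-root (≤-trans
      (+-mono-≤ (Represents-ℓ-depth rw) (Represents-ℓ-depth rw′))
      (within-depth-bound (Sum.map (Represents-ℓ-InBranch rw) (Represents-ℓ-InBranch rw′) some)
                          (project-within wd)))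
    ... | no none
      with Represents-¬InBranch rw (none ∘ inj₁) | Represents-¬InBranch rw′ (none ∘ inj₂)
    ...   | refl | refl = project-within wd

theorem4 : (k : ℕ) → 1 ≤ k → (n : ℕ) (T : SimpleGraph n) → IsTree (toGraph T) →
    (x : Fin n) (d : ℕ) (vs : Fin (suc d) → Fin n) → Injective _≡_ _≡_ vs →
    (∀ i → adj T x (vs i) ≡ true) →
    (∀ i u → IncDesc (toGraph T) x (vs i) u → WithinDist (toGraph T) ⌊ k /2⌋ x u) →
    (ℓ : Fin n) → IsLeaf (toGraph T) ℓ → IncDesc (toGraph T) x (vs zero) ℓ →
    Dist (toGraph T) x ℓ ⌊ k /2⌋ →
    (q : ℕ) → IsGammaAllInf k (Induced T (Keep T x vs ℓ)) q ⇔ IsGammaAllInf k (toGraph T) q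
theorem4 k _ n T tree x d vs vs-injective x-vs shallow ℓ _ vs₀-ℓ depth-ℓ =
  IsGammaAllInf-⇔ expand collapse
  where open Reduction k n T tree x d vs vs-injective x-vs shallow ℓ vs₀-ℓ depth-ℓ
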